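{- Let $C$ be a nonempty subset of a metric space $(X,d)$ which is totally bounded with II-modulus of total boundedness $\gamma$, let $T:C\to C$ be nonexpansive with $Fix(T)\ne\emptyset$, let $x\in C$ and $x_n:=T^nx$, and assume $(x_n)$ is asymptotically regular with rate of asymptotic regularity $\Phi^{++}$. Then for all $k\in\mathbb{N}$ and all $g:\mathbb{N}\to\mathbb{N}$ there exists $N\le\Theta(k,g,\Phi^{++},\gamma)$ such that for all $i,j\in[N,N+g(N)]$ and all $m\ge N$: $d(x_i,x_j)\le\frac1{k+1}$ and $d(x_m,Tx_m)\le\frac1{k+1}$. Here $K:=(\Phi^{++})^M(k)$, $\Theta(k,g,\Phi^{++},\gamma):=\Theta_0(\gamma^M(4k+3))+K$, $\Theta_0(0):=0$ and $\Theta_0(n+1):=(\Phi^{++})^M\left((g^M(\Theta_0(n)+K)+K)(4k+4)\right)$.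
   Context: Nonexpansive: $d(Tx,Ty)\le d(x,y)$. II-modulus of total boundedness of $C$: $\gamma$ with: for every $k$ and every sequence $(y_n)$ in $C$ there exist $0\le i<j\le\gamma(k)$ with $d(y_i,y_j)\le\frac1{k+1}$. A rate of asymptotic regularity is $\Phi^{++}:\mathbb{N}\to\mathbb{N}$ such that $d(x_n,Tx_n)\le\frac1{k+1}$ for all $k$ and all $n\ge\Phi^{++}(k)$. For $f:\mathbb{N}\to\mathbb{N}$, $f^M(n):=\max\{f(i)\mid i\le n\}$. -}

module Defs where

open import Level using (Level; _⊔_) renaming (suc to lsuc)
open import Data.Nat as ℕ using (ℕ; zero; suc)
open import Data.Product using (Σ; proj₁)
open import Relation.Binary.PropositionalEquality using (_≡_)
open import Relation.Nullary using (¬_)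
open import Algebra.Structures using (IsCommutativeRing)
open import Relation.Binary.Structures using (IsTotalOrder)

-- Ordered fields (the real numbers are one instance).  The inverse is
-- total with the (irrelevant) convention that 0⁻¹ is arbitrary; only the
-- law x * x⁻¹ = 1 for x ≠ 0 is assumed.

record OrderedField (c : Level) : Set (lsuc c) where
  infixl 6 _+_
  infixl 7 _*_
  infix  4 _≤_
  field
    Carrier : Set c
    0# 1#   : Carrier
    _+_ _*_ : Carrier → Carrier → Carrier
    -_      : Carrier → Carrier
    _⁻¹     : Carrier → Carrier
    _≤_     : Carrier → Carrier → Set c
    isCommutativeRing : IsCommutativeRing _≡_ _+_ _*_ -_ 0# 1#
    isTotalOrder      : IsTotalOrder _≡_ _≤_
    +-mono-≤  : ∀ {a b} c → a ≤ b → a + c ≤ b + c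
    *-nonneg  : ∀ {a b} → 0# ≤ a → 0# ≤ b → 0# ≤ a * b
    0≢1       : ¬ (0# ≡ 1#)
    ⁻¹-inverse : ∀ x → ¬ (x ≡ 0#) → x * (x ⁻¹) ≡ 1#

  fromℕ : ℕ → Carrier
  fromℕ zero    = 0#
  fromℕ (suc n) = fromℕ n + 1#

  1/[1+_] : ℕ → Carrier
  1/[1+ k ] = fromℕ (suc k) ⁻¹

record MetricSpace {c : Level} (F : OrderedField c) (a : Level) : Set (lsuc a ⊔ c) where
  open OrderedField F
  field
    X      : Set a
    d      : X → X → Carrier
    d-refl : ∀ x → d x x ≡ 0#
    d-eq   : ∀ x y → d x y ≡ 0# → x ≡ y
    d-sym  : ∀ x y → d x y ≡ d y x
    d-tri  : ∀ x y z → d x z ≤ d x y + d y z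

-- f^M(n) = max { f i | i ≤ n }

maxUpTo : (ℕ → ℕ) → ℕ → ℕ
maxUpTo f zero    = f zero
maxUpTo f (suc n) = maxUpTo f n ℕ.⊔ f (suc n)

-- Θ₀ and Θ from Theorem 7.8  (Φ plays the role of Φ⁺⁺)
Θ₀ : (k : ℕ) (g Φ : ℕ → ℕ) → ℕ → ℕ
Θ₀ k g Φ zero    = 0
Θ₀ k g Φ (suc n) =
  maxUpTo Φ ((maxUpTo g (Θ₀ k g Φ n ℕ.+ maxUpTo Φ k) ℕ.+ maxUpTo Φ k) ℕ.* (4 ℕ.* k ℕ.+ 4))

Θ : (k : ℕ) (g Φ γ : ℕ → ℕ) → ℕ
Θ k g Φ γ = Θ₀ k g Φ (maxUpTo γ (4 ℕ.* k ℕ.+ 3)) ℕ.+ maxUpTo Φ k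

iter : ∀ {a} {A : Set a} → (A → A) → ℕ → A → A
iter f zero    x = x
iter f (suc n) x = f (iter f n x)

module Submission where

-- Write x_n = Tⁿx, K = Φ^M(k), q = 4k+3 and z_n = x_(Θ₀(n)+K).  Total
-- boundedness applied to (z_n) yields I < J ≤ γ(q) with d(z_I,z_J) ≤ 1/(q+1).
-- Put N = Θ₀(I)+K and M = Θ₀(J)+K.  Since Θ₀ is monotone, M ≥ Θ₀(I+1) =
-- Φ^M(r) with r = (g^M(N)+K)(q+1), so every step d(x_p,x_(p+1)) with p ≥ M
-- is at most 1/(r+1).  For N ≤ i ≤ j ≤ N+g(N) the triangle inequality
-- along  x_i → x_(i-N+M) → x_(j-N+M) → x_j  gives three terms: the outer two
-- are ≤ d(x_N,x_M) by nonexpansiveness, the middle one is at most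
-- (j-i)/(r+1) ≤ 1/(q+1) by telescoping; and 3/(4k+4) ≤ 1/(k+1).

open import Defs
open import Data.Nat as ℕ using (ℕ; zero; suc; _<_)
import Data.Nat.Properties as NP
open import Data.Product using (Σ; proj₁; _×_; _,_)
open import Data.Sum using (inj₁; inj₂)
open import Data.Empty using (⊥-elim)
open import Relation.Nullary using (¬_)
open import Relation.Binary.PropositionalEquality
  using (_≡_; refl; sym; trans; cong; subst₂)
open import Relation.Binary.Bundles using (Poset)
open import Relation.Binary.Structures using (IsTotalOrder)
open import Algebra.Bundles using (CommutativeRing)
open import Algebra.Structures using (IsCommutativeRing)

module OrderedFieldFacts {c} (F : OrderedField c) where
  open OrderedField F
  open IsTotalOrder isTotalOrder using (total; antisym; isPartialOrder)
    renaming (refl to ≤-refl)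
  module R = IsCommutativeRing isCommutativeRing

  commutativeRing : CommutativeRing c c
  commutativeRing = record { isCommutativeRing = isCommutativeRing }
  open CommutativeRing commutativeRing using (commutativeSemiring; ring)
  open import Algebra.Solver.Ring.NaturalCoefficients.Default commutativeSemiring
  open import Algebra.Properties.Ring ring
    using (-1*x≈-x; -‿involutive; -‿distribˡ-*; -‿distribʳ-*)

  poset : Poset c c c
  poset = record { isPartialOrder = isPartialOrder }
  open import Relation.Binary.Reasoning.PartialOrder poset public

  +-mono-≤₂ : ∀ {a b a′ b′} → a ≤ b → a′ ≤ b′ → a + a′ ≤ b + b′
  +-mono-≤₂ {a} {b} {a′} {b′} a≤b a′≤b′ = begin
    a + a′  ≤⟨ +-mono-≤ a′ a≤b ⟩
    b + a′  ≡⟨ R.+-comm b a′ ⟩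
    a′ + b  ≤⟨ +-mono-≤ b a′≤b′ ⟩
    b′ + b  ≡⟨ R.+-comm b′ b ⟩
    b + b′  ∎

  ≤⇒0≤- : ∀ {a b} → a ≤ b → 0# ≤ b + - a
  ≤⇒0≤- {a} {b} a≤b = begin
    0#      ≡⟨ sym (R.-‿inverseʳ a) ⟩
    a + - a ≤⟨ +-mono-≤ (- a) a≤b ⟩
    b + - a ∎

  0≤-⇒≤ : ∀ {a b} → 0# ≤ b + - a → a ≤ b
  0≤-⇒≤ {a} {b} 0≤b-a = begin
    a              ≡⟨ sym (R.+-identityˡ a) ⟩
    0# + a         ≤⟨ +-mono-≤ a 0≤b-a ⟩
    (b + - a) + a  ≡⟨ R.+-assoc b (- a) a ⟩
    b + (- a + a)  ≡⟨ cong (b +_) (R.-‿inverseˡ a) ⟩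
    b + 0#         ≡⟨ R.+-identityʳ b ⟩
    b              ∎

  *-monoˡ-≤ : ∀ {a b e} → 0# ≤ e → a ≤ b → a * e ≤ b * e
  *-monoˡ-≤ {a} {b} {e} 0≤e a≤b = 0≤-⇒≤ (begin
    0#                ≤⟨ *-nonneg (≤⇒0≤- a≤b) 0≤e ⟩
    (b + - a) * e     ≡⟨ R.distribʳ e b (- a) ⟩
    b * e + - a * e   ≡⟨ cong (b * e +_) (sym (-‿distribˡ-* a e)) ⟩
    b * e + - (a * e) ∎)

  0≤-a⇒a≤0 : ∀ {a} → 0# ≤ - a → a ≤ 0#
  0≤-a⇒a≤0 {a} 0≤-a = begin
    a        ≡⟨ sym (R.+-identityˡ a) ⟩
    0# + a   ≤⟨ +-mono-≤ a 0≤-a ⟩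
    - a + a  ≡⟨ R.-‿inverseˡ a ⟩
    0#       ∎

  a≤0⇒0≤-a : ∀ {a} → a ≤ 0# → 0# ≤ - a
  a≤0⇒0≤-a {a} a≤0 = subst₂ _≤_ refl (R.+-identityˡ (- a)) (≤⇒0≤- a≤0)

  0≤1 : 0# ≤ 1#
  0≤1 with total 0# 1#
  ... | inj₁ 0≤1 = 0≤1
  ... | inj₂ 1≤0 = subst₂ _≤_ refl square (*-nonneg 0≤-1 0≤-1)
    where
    0≤-1 : 0# ≤ - 1#
    0≤-1 = a≤0⇒0≤-a 1≤0
    square : - 1# * - 1# ≡ 1#
    square = trans (-1*x≈-x (- 1#)) (-‿involutive 1#)

  fromℕ-nonneg : ∀ n → 0# ≤ fromℕ n
  fromℕ-nonneg zero    = ≤-refl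
  fromℕ-nonneg (suc n) = subst₂ _≤_ (R.+-identityˡ 0#) refl
                           (+-mono-≤₂ (fromℕ-nonneg n) 0≤1)

  fromℕ-suc≢0 : ∀ n → ¬ (fromℕ (suc n) ≡ 0#)
  fromℕ-suc≢0 n n+1≡0 = 0≢1 (antisym 0≤1 1≤0)
    where
    1≤0 : 1# ≤ 0#
    1≤0 = begin
      1#              ≡⟨ sym (R.+-identityˡ 1#) ⟩
      0# + 1#         ≤⟨ +-mono-≤ 1# (fromℕ-nonneg n) ⟩
      fromℕ (suc n)   ≡⟨ n+1≡0 ⟩
      0#              ∎

  -- 1/(n+1) is nonnegative: otherwise (n+1)·(-1/(n+1)) = -1 would be ≥ 0.
  1/[1+]-nonneg : ∀ n → 0# ≤ 1/[1+ n ]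
  1/[1+]-nonneg n with total 0# 1/[1+ n ]
  ... | inj₁ 0≤v = 0≤v
  ... | inj₂ v≤0 = ⊥-elim (0≢1 (antisym 0≤1 (0≤-a⇒a≤0 0≤-1)))
    where
    0≤-1 : 0# ≤ - 1#
    0≤-1 = begin
      0#                           ≤⟨ *-nonneg (fromℕ-nonneg (suc n)) (a≤0⇒0≤-a v≤0) ⟩
      fromℕ (suc n) * - 1/[1+ n ]  ≡⟨ sym (-‿distribʳ-* (fromℕ (suc n)) 1/[1+ n ]) ⟩
      - (fromℕ (suc n) * 1/[1+ n ]) ≡⟨ cong -_ (⁻¹-inverse _ (fromℕ-suc≢0 n)) ⟩
      - 1#                         ∎

  fromℕ-+ : ∀ m n → fromℕ (m ℕ.+ n) ≡ fromℕ m + fromℕ n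
  fromℕ-+ zero    n = sym (R.+-identityˡ _)
  fromℕ-+ (suc m) n = begin-equality
    fromℕ (m ℕ.+ n) + 1#       ≡⟨ cong (_+ 1#) (fromℕ-+ m n) ⟩
    (fromℕ m + fromℕ n) + 1#   ≡⟨ solve 3 (λ a b o → (a :+ b) :+ o := (a :+ o) :+ b)
                                    refl (fromℕ m) (fromℕ n) 1# ⟩
    (fromℕ m + 1#) + fromℕ n   ∎

  fromℕ-* : ∀ m n → fromℕ (m ℕ.* n) ≡ fromℕ m * fromℕ n
  fromℕ-* zero    n = sym (R.zeroˡ _)
  fromℕ-* (suc m) n = begin-equality
    fromℕ (n ℕ.+ m ℕ.* n)        ≡⟨ fromℕ-+ n (m ℕ.* n) ⟩
    fromℕ n + fromℕ (m ℕ.* n)    ≡⟨ cong (fromℕ n +_) (fromℕ-* m n) ⟩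
    fromℕ n + fromℕ m * fromℕ n  ≡⟨ solve 2 (λ a b → b :+ a :* b := (a :+ con 1) :* b)
                                      refl (fromℕ m) (fromℕ n) ⟩
    (fromℕ m + 1#) * fromℕ n     ∎

  fromℕ-mono : ∀ {m n} → m ℕ.≤ n → fromℕ m ≤ fromℕ n
  fromℕ-mono {m} {n} m≤n = begin
    fromℕ m                      ≡⟨ sym (R.+-identityʳ _) ⟩
    fromℕ m + 0#                 ≤⟨ +-mono-≤₂ ≤-refl (fromℕ-nonneg (n ℕ.∸ m)) ⟩
    fromℕ m + fromℕ (n ℕ.∸ m)    ≡⟨ sym (fromℕ-+ m (n ℕ.∸ m)) ⟩
    fromℕ (m ℕ.+ (n ℕ.∸ m))      ≡⟨ cong fromℕ (NP.m+[n∸m]≡n m≤n) ⟩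
    fromℕ n                      ∎

  scaled-1/[1+]-≤ : ∀ l q r → l ℕ.* suc q ℕ.≤ r → fromℕ l * 1/[1+ r ] ≤ 1/[1+ q ]
  scaled-1/[1+]-≤ l q r lq≤r = begin
    fromℕ l * 1/[1+ r ]                 ≡⟨ regroup ⟩
    ((fromℕ l * S) * 1/[1+ r ]) * 1/[1+ q ]
      ≤⟨ *-monoˡ-≤ (1/[1+]-nonneg q) (*-monoˡ-≤ (1/[1+]-nonneg r) lS≤R) ⟩
    (R′ * 1/[1+ r ]) * 1/[1+ q ]        ≡⟨ cong (_* 1/[1+ q ]) (⁻¹-inverse R′ (fromℕ-suc≢0 r)) ⟩
    1# * 1/[1+ q ]                      ≡⟨ R.*-identityˡ _ ⟩
    1/[1+ q ]                           ∎
    where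
    S R′ : Carrier
    S  = fromℕ (suc q)
    R′ = fromℕ (suc r)
    lS≤R : fromℕ l * S ≤ R′
    lS≤R = subst₂ _≤_ (fromℕ-* l (suc q)) refl (fromℕ-mono (NP.m≤n⇒m≤1+n lq≤r))
    regroup : fromℕ l * 1/[1+ r ] ≡ ((fromℕ l * S) * 1/[1+ r ]) * 1/[1+ q ]
    regroup = begin-equality
      fromℕ l * 1/[1+ r ]                         ≡⟨ sym (R.*-identityʳ _) ⟩
      (fromℕ l * 1/[1+ r ]) * 1#                  ≡⟨ cong (fromℕ l * 1/[1+ r ] *_)
                                                       (sym (⁻¹-inverse S (fromℕ-suc≢0 q))) ⟩
      (fromℕ l * 1/[1+ r ]) * (S * 1/[1+ q ])     ≡⟨ solve 4 (λ a u s v → (a :* u) :* (s :* v)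
                                                                   := ((a :* s) :* u) :* v)
                                                       refl (fromℕ l) 1/[1+ r ] S 1/[1+ q ] ⟩
      ((fromℕ l * S) * 1/[1+ r ]) * 1/[1+ q ]     ∎

  triple : ∀ e → e + (e + e) ≡ fromℕ 3 * e
  triple = solve 1 (λ e → e :+ (e :+ e) := (((con 0 :+ con 1) :+ con 1) :+ con 1) :* e) refl

  fromℕ-suc-* : ∀ t u → fromℕ t * u + u ≡ fromℕ (suc t) * u
  fromℕ-suc-* t = solve 2 (λ a b → a :* b :+ b := (a :+ con 1) :* b) refl (fromℕ t)

-- 3(k+1) ≤ 4k+3; this is why three errors of size 1/(4k+4) fit into 1/(k+1).
three-parts : ∀ k → 3 ℕ.* suc k ℕ.≤ 4 ℕ.* k ℕ.+ 3
three-parts k = begin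
  3 ℕ.* suc k      ≡⟨ NP.*-suc 3 k ⟩
  3 ℕ.+ 3 ℕ.* k    ≡⟨ NP.+-comm 3 (3 ℕ.* k) ⟩
  3 ℕ.* k ℕ.+ 3    ≤⟨ NP.+-monoˡ-≤ 3 (NP.*-monoˡ-≤ k (NP.n≤1+n 3)) ⟩
  4 ℕ.* k ℕ.+ 3    ∎
  where open NP.≤-Reasoning

step-mono : (f : ℕ → ℕ) → (∀ n → f n ℕ.≤ f (suc n)) → ∀ {m n} → m ℕ.≤ n → f m ℕ.≤ f n
step-mono f step m≤n = go (NP.≤⇒≤′ m≤n)
  where
  go : ∀ {m n} → m ℕ.≤′ n → f m ℕ.≤ f n
  go ℕ.≤′-refl      = NP.≤-refl
  go (ℕ.≤′-step p) = NP.≤-trans (go p) (step _)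

maxUpTo-≥ : ∀ f n → f n ℕ.≤ maxUpTo f n
maxUpTo-≥ f zero    = NP.≤-refl
maxUpTo-≥ f (suc n) = NP.m≤n⊔m (maxUpTo f n) (f (suc n))

maxUpTo-mono : ∀ f {m n} → m ℕ.≤ n → maxUpTo f m ℕ.≤ maxUpTo f n
maxUpTo-mono f = step-mono (maxUpTo f) (λ n → NP.m≤m⊔n (maxUpTo f n) (f (suc n)))

-- Θ₀ is monotone; this is what makes the bound on the step size at M valid.
Θ₀-mono : ∀ k g Φ {m n} → m ℕ.≤ n → Θ₀ k g Φ m ℕ.≤ Θ₀ k g Φ n
Θ₀-mono k g Φ = step-mono (Θ₀ k g Φ) Θ₀-step
  where
  Θ₀-step : ∀ n → Θ₀ k g Φ n ℕ.≤ Θ₀ k g Φ (suc n)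
  Θ₀-step zero    = ℕ.z≤n
  Θ₀-step (suc n) = maxUpTo-mono Φ (NP.*-monoˡ-≤ (4 ℕ.* k ℕ.+ 4)
    (NP.+-monoˡ-≤ (maxUpTo Φ k) (maxUpTo-mono g (NP.+-monoˡ-≤ (maxUpTo Φ k) (Θ₀-step n)))))

module OrbitEstimates {c a} (F : OrderedField c) (Sp : MetricSpace F a) where
  open OrderedField F
  open MetricSpace Sp
  open OrderedFieldFacts F
  open IsTotalOrder isTotalOrder using () renaming (refl to ≤-refl; trans to ≤-trans)

  module Orbit {ℓ} (C : X → Set ℓ) (T : Σ X C → Σ X C)
    (nonexpansive : ∀ u v → d (proj₁ (T u)) (proj₁ (T v)) ≤ d (proj₁ u) (proj₁ v))
    (x : Σ X C) where

    -- D i j = d(x_i, x_j); note D p (suc p) = d(x_p, T x_p) definitionally.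
    D : ℕ → ℕ → Carrier
    D i j = d (proj₁ (iter T i x)) (proj₁ (iter T j x))

    D-sym : ∀ i j → D i j ≡ D j i
    D-sym i j = d-sym _ _

    shift : ∀ t i j → D (t ℕ.+ i) (t ℕ.+ j) ≤ D i j
    shift zero    i j = ≤-refl
    shift (suc t) i j = ≤-trans (nonexpansive _ _) (shift t i j)

    telescope : ∀ n u → (∀ p → n ℕ.≤ p → D p (suc p) ≤ u) →
                ∀ t → D n (t ℕ.+ n) ≤ fromℕ t * u
    telescope n u small zero    = subst₂ _≤_ (sym (d-refl _)) (sym (R.zeroˡ u)) ≤-refl
    telescope n u small (suc t) = begin
      D n (suc t ℕ.+ n)                     ≤⟨ d-tri _ _ _ ⟩
      D n (t ℕ.+ n) + D (t ℕ.+ n) (suc t ℕ.+ n)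
        ≤⟨ +-mono-≤₂ (telescope n u small t) (small (t ℕ.+ n) (NP.m≤n+m n t)) ⟩
      fromℕ t * u + u                       ≡⟨ fromℕ-suc-* t u ⟩
      fromℕ (suc t) * u                     ∎

    D-wlog : ∀ {p} (P : ℕ → Set p) b → (∀ i j → i ℕ.≤ j → P i → P j → D i j ≤ b) →
             ∀ i j → P i → P j → D i j ≤ b
    D-wlog P b ordered i j Pi Pj with NP.≤-total i j
    ... | inj₁ i≤j = ordered i j i≤j Pi Pj
    ... | inj₂ j≤i = subst₂ _≤_ (D-sym j i) refl (ordered j i j≤i Pj Pi)

    -- Window bound: if x_N and x_M are e-close and all steps after M are ≤ u,
    -- then for N ≤ i ≤ j, going through x_(i-N+M) and x_(j-N+M),
    -- D i j ≤ e + ((j-i)·u + e).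
    module Window (N M : ℕ) (e u : Carrier) (close : D N M ≤ e)
      (small : ∀ p → M ℕ.≤ p → D p (suc p) ≤ u) where

      window-shifted : ∀ l t → D (l ℕ.+ N) (t ℕ.+ (l ℕ.+ N)) ≤ e + (fromℕ t * u + e)
      window-shifted l t = begin
        D (l ℕ.+ N) (t ℕ.+ (l ℕ.+ N))
          ≤⟨ d-tri _ _ _ ⟩
        D (l ℕ.+ N) (l ℕ.+ M) + D (l ℕ.+ M) (t ℕ.+ (l ℕ.+ N))
          ≤⟨ +-mono-≤₂ ≤-refl (d-tri _ _ _) ⟩
        D (l ℕ.+ N) (l ℕ.+ M) + (D (l ℕ.+ M) (t ℕ.+ (l ℕ.+ M)) + D (t ℕ.+ (l ℕ.+ M)) (t ℕ.+ (l ℕ.+ N)))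
          ≤⟨ +-mono-≤₂ (≤-trans (shift l N M) close)
               (+-mono-≤₂ middle (subst₂ _≤_ (D-sym (t ℕ.+ (l ℕ.+ N)) (t ℕ.+ (l ℕ.+ M))) refl
                                  (≤-trans outer close))) ⟩
        e + (fromℕ t * u + e) ∎
        where
        middle : D (l ℕ.+ M) (t ℕ.+ (l ℕ.+ M)) ≤ fromℕ t * u
        middle = telescope (l ℕ.+ M) u (λ p l+M≤p → small p (NP.≤-trans (NP.m≤n+m M l) l+M≤p)) t
        outer : D (t ℕ.+ (l ℕ.+ N)) (t ℕ.+ (l ℕ.+ M)) ≤ D N M
        outer = subst₂ _≤_ (cong₂′ (NP.+-assoc t l N) (NP.+-assoc t l M)) refl (shift (t ℕ.+ l) N M)
          where
          cong₂′ : ∀ {i i′ j j′} → i ≡ i′ → j ≡ j′ → D i j ≡ D i′ j′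
          cong₂′ refl refl = refl

      window : ∀ i j → N ℕ.≤ i → i ℕ.≤ j → D i j ≤ e + (fromℕ (j ℕ.∸ i) * u + e)
      window i j N≤i i≤j =
        subst₂ (λ i′ j′ → D i′ j′ ≤ e + (fromℕ (j ℕ.∸ i) * u + e)) i≡ j≡
          (window-shifted (i ℕ.∸ N) (j ℕ.∸ i))
        where
        i≡ : i ℕ.∸ N ℕ.+ N ≡ i
        i≡ = NP.m∸n+n≡m N≤i
        j≡ : j ℕ.∸ i ℕ.+ (i ℕ.∸ N ℕ.+ N) ≡ j
        j≡ = trans (cong (j ℕ.∸ i ℕ.+_) i≡) (NP.m∸n+n≡m i≤j)

    module Metastability (Φ : ℕ → ℕ)
      (rate : ∀ k n → Φ k ℕ.≤ n → D n (suc n) ≤ 1/[1+ k ]) (k : ℕ) (g : ℕ → ℕ) where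

      K q : ℕ
      K = maxUpTo Φ k
      q = 4 ℕ.* k ℕ.+ 3

      windowStart : ℕ → ℕ
      windowStart n = Θ₀ k g Φ n ℕ.+ K

      steps-after-K : ∀ m → K ℕ.≤ m → D m (suc m) ≤ 1/[1+ k ]
      steps-after-K m K≤m = rate k m (NP.≤-trans (maxUpTo-≥ Φ k) K≤m)

      window-from-close-pair : ∀ I J → I < J → D (windowStart I) (windowStart J) ≤ 1/[1+ q ] →
        let N = windowStart I in
        ∀ i j → N ℕ.≤ i × i ℕ.≤ N ℕ.+ g N → N ℕ.≤ j × j ℕ.≤ N ℕ.+ g N → D i j ≤ 1/[1+ k ]
      window-from-close-pair I J I<J close =
        D-wlog (λ i → N ℕ.≤ i × i ℕ.≤ N ℕ.+ g N) 1/[1+ k ] ordered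
        where
        N M r : ℕ
        N = windowStart I
        M = windowStart J
        r = (maxUpTo g N ℕ.+ K) ℕ.* suc q

        -- M ≥ Θ₀(I+1) = Φ^M(r), so steps after M are ≤ 1/(r+1).
        small : ∀ p → M ℕ.≤ p → D p (suc p) ≤ 1/[1+ r ]
        small p M≤p = rate r p (NP.≤-trans (maxUpTo-≥ Φ r)
          (NP.≤-trans (NP.≤-trans (NP.≤-reflexive Θ₀-suc) (Θ₀-mono k g Φ I<J))
                      (NP.≤-trans (NP.m≤m+n _ K) M≤p)))
          where
          Θ₀-suc : maxUpTo Φ r ≡ Θ₀ k g Φ (suc I)
          Θ₀-suc = cong (λ s → maxUpTo Φ ((maxUpTo g N ℕ.+ K) ℕ.* s)) (sym (NP.+-suc (4 ℕ.* k) 3))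

        open Window N M 1/[1+ q ] 1/[1+ r ] close small

        ordered : ∀ i j → i ℕ.≤ j → N ℕ.≤ i × i ℕ.≤ N ℕ.+ g N →
                  N ℕ.≤ j × j ℕ.≤ N ℕ.+ g N → D i j ≤ 1/[1+ k ]
        ordered i j i≤j (N≤i , _) (_ , j≤N+gN) = begin
          D i j                                  ≤⟨ window i j N≤i i≤j ⟩
          e + (fromℕ (j ℕ.∸ i) * 1/[1+ r ] + e)  ≤⟨ +-mono-≤₂ ≤-refl (+-mono-≤ e
                                                      (scaled-1/[1+]-≤ (j ℕ.∸ i) q r span)) ⟩
          e + (e + e)                            ≡⟨ triple e ⟩
          fromℕ 3 * e                            ≤⟨ scaled-1/[1+]-≤ 3 k q (three-parts k) ⟩
          1/[1+ k ]                              ∎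
          where
          e : Carrier
          e = 1/[1+ q ]
          -- j - i ≤ g(N) ≤ g^M(N) + K
          span : (j ℕ.∸ i) ℕ.* suc q ℕ.≤ r
          span = NP.*-monoˡ-≤ (suc q) (NP.≤-trans (NP.∸-monoʳ-≤ j N≤i)
                   (NP.≤-trans (NP.∸-monoˡ-≤ N j≤N+gN)
                   (NP.≤-trans (NP.≤-reflexive (NP.m+n∸m≡n N (g N)))
                   (NP.≤-trans (maxUpTo-≥ g N) (NP.m≤m+n _ K)))))

theorem7p8 : ∀ {c a ℓ} (F : OrderedField c) (M : MetricSpace F a) →
  let open OrderedField F
      open MetricSpace M
  in (C : X → Set ℓ) → (γ : ℕ → ℕ) →
     (∀ (k : ℕ) (y : ℕ → Σ X C) → Σ ℕ λ i → Σ ℕ λ j →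
        i < j × j ℕ.≤ γ k × d (proj₁ (y i)) (proj₁ (y j)) ≤ 1/[1+ k ]) →
     (T : Σ X C → Σ X C) →
     (∀ u v → d (proj₁ (T u)) (proj₁ (T v)) ≤ d (proj₁ u) (proj₁ v)) →
     (Σ (Σ X C) λ p → proj₁ (T p) ≡ proj₁ p) →
     (x : Σ X C) → (Φ : ℕ → ℕ) →
     (∀ k n → Φ k ℕ.≤ n →
        d (proj₁ (iter T n x)) (proj₁ (T (iter T n x))) ≤ 1/[1+ k ]) →
     ∀ (k : ℕ) (g : ℕ → ℕ) → Σ ℕ λ N →
       N ℕ.≤ Θ k g Φ γ ×
       (∀ i j → N ℕ.≤ i → i ℕ.≤ N ℕ.+ g N → N ℕ.≤ j → j ℕ.≤ N ℕ.+ g N →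
          d (proj₁ (iter T i x)) (proj₁ (iter T j x)) ≤ 1/[1+ k ]) ×
       (∀ m → N ℕ.≤ m →
          d (proj₁ (iter T m x)) (proj₁ (T (iter T m x))) ≤ 1/[1+ k ])
theorem7p8 F Sp C γ totallyBounded T nonexpansive _ x Φ rate k g with
  totallyBounded (4 ℕ.* k ℕ.+ 3) (λ n → iter T (Θ₀ k g Φ n ℕ.+ maxUpTo Φ k) x)
... | I , J , I<J , J≤γq , close = N , N≤Θ , inWindow , tail
  where
  open OrderedField F using (_≤_; 1/[1+_])
  open OrbitEstimates F Sp
  open Orbit C T nonexpansive x
  open Metastability Φ rate k g

  N : ℕ
  N = windowStart I

  N≤Θ : N ℕ.≤ Θ k g Φ γ
  N≤Θ = NP.+-monoˡ-≤ K (Θ₀-mono k g Φ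
          (NP.≤-trans (NP.<⇒≤ I<J) (NP.≤-trans J≤γq (maxUpTo-≥ γ q))))

  inWindow : ∀ i j → N ℕ.≤ i → i ℕ.≤ N ℕ.+ g N → N ℕ.≤ j → j ℕ.≤ N ℕ.+ g N → D i j ≤ 1/[1+ k ]
  inWindow i j N≤i i≤ N≤j j≤ =
    window-from-close-pair I J I<J close i j (N≤i , i≤) (N≤j , j≤)

  tail : ∀ m → N ℕ.≤ m → D m (suc m) ≤ 1/[1+ k ]
  tail m N≤m = steps-after-K m (NP.≤-trans (NP.m≤n+m K (Θ₀ k g Φ I)) N≤m)
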